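{- Consider the dynamic program for Min-Max Disjoint Paths on a series-parallel digraph $D$ in which, for each table cell, among all candidate path profiles with $k'$ paths of lengths $p_1\ge\dots\ge p_{k'}$ the one minimizing $p_1-p_{k'}$ is selected in case of a series composition, and the one minimizing $p_1$ in case of a parallel composition. Then the objective value $\mathrm{DP}$ of the computed solution satisfies $\mathrm{DP}\le(\phi(D)+1)\cdot\mathrm{OPT}$, where $\mathrm{OPT}$ is the optimal objective value.
   Context: Min-Max Disjoint Paths: given a digraph $D$ with source $s$, sink $t$, travel times $\tau:A\to\mathbb{Z}_{\ge0}$ and integer $k$, find $k$ pairwise arc-disjoint $s$-$t$-paths (a path profile) minimizing the maximum path length. $D$ is series-parallel with a fixed binary decomposition tree (leaves = arcs, internal vertices labeled $S$ or $P$ = series or parallel composition of their two children; series composition identifies the sink of the first with the source of the second, parallel identifies sources and sinks). An $S$-component is a maximal connected set of $S$-labeled tree vertices; $\phi(D)$ is the maximum number of $S$-components traversed on a root-to-leaf path of the tree. The dynamic program has a cell $(D',k',\theta')$ for each subgraph $D'$ corresponding to a tree vertex, each $k'\in\{0,\dots,k\}$ and each $\theta'$ in the set $\Theta$ of possible total lengths; a cell stores at most one path profile of $D'$ with $k'$ paths of total length $\theta'$ (sum of path lengths in $D'$). For a single arc $a$: $(D',1,\tau_a)$ stores $\{(a)\}$, $(D',0,0)$ stores the empty profile, other cells are empty. For $D'\circ D''$, the candidates of cell $(D'\circ D'',\tilde k,\tilde\theta)$ are the greedy compositions of the profiles stored in $(D',k',\theta')$ and $(D'',k'',\theta'')$ over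 all $\theta'+\theta''=\tilde\theta$ with $\tilde k=k'+k''$ (parallel) or $\tilde k=k'=k''$ (series); greedy series composition pairs the longest path of the first profile with the shortest of the second, the second-longest with the second-shortest, etc.; greedy parallel composition takes the union. One candidate is stored according to the selection rule. Finally, among the profiles stored in cells $(D,k,\theta)$, $\theta\in\Theta$, the one with smallest maximum path length is output. -}

module Defs where

open import Data.Nat using (ℕ; zero; suc; _+_; _*_; _∸_; _≤_; _⊔_; _⊓_)
open import Data.Bool using (Bool; true; false; if_then_else_)
open import Data.List using (List; []; _∷_; map; foldr; length; lookup; zipWith; _++_)
open import Data.List.Relation.Binary.Permutation.Propositional using (_↭_)
open import Data.List.Relation.Unary.Linked using (Linked)
open import Data.Fin using (Fin)
open import Data.Maybe using (Maybe; just; nothing)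
open import Data.Product using (Σ; ∃; ∃-syntax; _×_; _,_)
open import Relation.Binary.PropositionalEquality using (_≡_; _≢_)
open import Relation.Nullary using (¬_)

-- Series-parallel digraph given by its binary decomposition tree.
-- Leaves are arcs (labelled with their travel time τ_a),
-- internal vertices are S (series) or P (parallel) compositions.

data SP : Set where
  arc : ℕ → SP
  ser : SP → SP → SP
  par : SP → SP → SP

data Arc : SP → Set where
  this : ∀ {τ} → Arc (arc τ)
  inS₁ : ∀ {A B} → Arc A → Arc (ser A B)
  inS₂ : ∀ {A B} → Arc B → Arc (ser A B)
  inP₁ : ∀ {A B} → Arc A → Arc (par A B)
  inP₂ : ∀ {A B} → Arc B → Arc (par A B)

-- s-t-paths of the series-parallel digraph (source to sink).
data Path : SP → Set where
  single : ∀ {τ} → Path (arc τ)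
  _⨾_    : ∀ {A B} → Path A → Path B → Path (ser A B)
  left   : ∀ {A B} → Path A → Path (par A B)
  right  : ∀ {A B} → Path B → Path (par A B)

data Uses : ∀ {T} → Path T → Arc T → Set where
  uThis : ∀ {τ} → Uses (single {τ}) this
  uS₁   : ∀ {A B} {p : Path A} {q : Path B} {a} → Uses p a → Uses (p ⨾ q) (inS₁ a)
  uS₂   : ∀ {A B} {p : Path A} {q : Path B} {a} → Uses q a → Uses (p ⨾ q) (inS₂ a)
  uP₁   : ∀ {A B} {p : Path A} {a} → Uses p a → Uses (left {A} {B} p) (inP₁ a)
  uP₂   : ∀ {A B} {q : Path B} {a} → Uses q a → Uses (right {A} {B} q) (inP₂ a)

len : ∀ {T} → Path T → ℕ
len (single {τ}) = τ
len (p ⨾ q) = len p + len q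
len (left p) = len p
len (right q) = len q

Profile : SP → Set
Profile T = List (Path T)

ArcDisjoint : ∀ {T} → Profile T → Set
ArcDisjoint {T} P = (i j : Fin (length P)) → i ≢ j →
  (a : Arc T) → Uses (lookup P i) a → ¬ Uses (lookup P j) a

Feasible : (T : SP) → ℕ → Profile T → Set
Feasible T k P = length P ≡ k × ArcDisjoint P

maxL : List ℕ → ℕ
maxL = foldr _⊔_ 0

minL : List ℕ → ℕ
minL [] = 0
minL (x ∷ []) = x
minL (x ∷ y ∷ xs) = x ⊓ minL (y ∷ xs)

maxLen : ∀ {T} → Profile T → ℕ
maxLen P = maxL (map len P)

minLen : ∀ {T} → Profile T → ℕ
minLen P = minL (map len P)

-- greedy series composition: sort the first profile by non-increasing length,
-- the second by non-decreasing length (any tie-breaking), and concatenate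
-- pairwise (longest with shortest, ...).
GreedySer : ∀ {A B} → Profile A → Profile B → Profile (ser A B) → Set
GreedySer {A} {B} P Q R =
  Σ (Profile A) λ P' → Σ (Profile B) λ Q' →
    P ↭ P' × Q ↭ Q' ×
    Linked (λ p p' → len p' ≤ len p) P' ×
    Linked (λ q q' → len q ≤ len q') Q' ×
    length P' ≡ length Q' ×
    R ≡ zipWith _⨾_ P' Q'

greedyPar : ∀ {A B} → Profile A → Profile B → Profile (par A B)
greedyPar P Q = map left P ++ map right Q

-- The dynamic program.
-- A table of a tree vertex T assigns to every cell (k', θ') at most one
-- profile.  (θ' ranges over all of ℕ; cells with unattainable θ' are empty.)

Table : SP → Set
Table T = ℕ → ℕ → Maybe (Profile T)

arcCell : (τ : ℕ) → ℕ → ℕ → Maybe (Profile (arc τ))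
arcCell τ 0 0 = just []
arcCell τ 0 (suc _) = nothing
arcCell τ 1 θ with θ Data.Nat.≟ τ
... | Relation.Nullary.yes _ = just (single ∷ [])
... | Relation.Nullary.no _ = nothing
arcCell τ (suc (suc _)) θ = nothing

SerCand : ∀ {A B} → Table A → Table B → ℕ → ℕ → Profile (ser A B) → Set
SerCand {A} {B} tA tB k θ R =
  ∃[ θ₁ ] ∃[ θ₂ ] θ₁ + θ₂ ≡ θ ×
    Σ (Profile A) λ P → Σ (Profile B) λ Q →
      tA k θ₁ ≡ just P × tB k θ₂ ≡ just Q × GreedySer P Q R

ParCand : ∀ {A B} → Table A → Table B → ℕ → ℕ → Profile (par A B) → Set
ParCand {A} {B} tA tB k θ R =
  ∃[ k₁ ] ∃[ k₂ ] ∃[ θ₁ ] ∃[ θ₂ ] k₁ + k₂ ≡ k × θ₁ + θ₂ ≡ θ ×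
    Σ (Profile A) λ P → Σ (Profile B) λ Q →
      tA k₁ θ₁ ≡ just P × tB k₂ θ₂ ≡ just Q × R ≡ greedyPar P Q

data Selected {T : SP} (cost : Profile T → ℕ) (Cand : Profile T → Set)
     : Maybe (Profile T) → Set where
  none : (∀ R → ¬ Cand R) → Selected cost Cand nothing
  some : ∀ R → Cand R → (∀ R' → Cand R' → cost R ≤ cost R') →
         Selected cost Cand (just R)

serCost : ∀ {T} → Profile T → ℕ
serCost P = maxLen P ∸ minLen P

parCost : ∀ {T} → Profile T → ℕ
parCost P = maxLen P

data DPRun : (T : SP) → Table T → Set where
  runArc : ∀ {τ} {tab : Table (arc τ)} →
    (∀ k θ → tab k θ ≡ arcCell τ k θ) → DPRun (arc τ) tab
  runSer : ∀ {A B} {tA : Table A} {tB : Table B} {tab : Table (ser A B)} →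
    DPRun A tA → DPRun B tB →
    (∀ k θ → Selected serCost (SerCand tA tB k θ) (tab k θ)) →
    DPRun (ser A B) tab
  runPar : ∀ {A B} {tA : Table A} {tB : Table B} {tab : Table (par A B)} →
    DPRun A tA → DPRun B tB →
    (∀ k θ → Selected parCost (ParCand tA tB k θ) (tab k θ)) →
    DPRun (par A B) tab

DPOutput : ∀ {T} → Table T → ℕ → Profile T → Set
DPOutput tab k R =
  (∃[ θ ] tab k θ ≡ just R) ×
  (∀ θ R' → tab k θ ≡ just R' → maxLen R ≤ maxLen R')

-- φ(D): maximum number of S-components (maximal connected sets of
-- S-labelled tree vertices) traversed on a root-to-leaf path.
-- The flag says whether the parent is S-labelled (then an S-vertex
-- continues the parent's S-component rather than starting a new one).

phiAux : Bool → SP → ℕ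
phiAux b (arc _) = 0
phiAux b (ser A B) = (if b then 0 else 1) + (phiAux true A ⊔ phiAux true B)
phiAux b (par A B) = phiAux false A ⊔ phiAux false B

phi : SP → ℕ
phi = phiAux false

{-# OPTIONS --safe #-}
-- Fix an optimal profile with maximum path length M and restrict it to each subgraph of the
-- decomposition.  The cell indexed by the number and total length of the restricted paths is
-- nonempty, and the profile stored there obeys two bounds.  Greedy series composition does
-- not increase the spread (longest minus shortest path) and the series rule minimises it;
-- since the stored profile has the average path length of the restriction, at most M, each of
-- its paths is at most M plus the spread.  So the spread stays bounded inside an S-component
-- and every S-component costs one further M, while the parallel rule, minimising the longest
-- path, keeps the length bound, which then bounds the spread entering the next S-component.
module Submission where

open import Defs
open import Data.Nat using (ℕ; _≤_; _*_; _+_)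
open import Data.Product using (_×_)

open import Data.Bool using (true)
open import Data.Empty using (⊥-elim)
open import Data.List using (List; []; _∷_; map; zipWith; length; _++_)
open import Data.List.Membership.Propositional using (_∈_; find)
open import Data.List.Properties
  using (length-map; length-++; map-++; map-∘; length-zipWith; map-zipWith; zipWith-map; tabulate-lookup)
open import Data.List.Relation.Binary.Permutation.Propositional using (_↭_; refl; prep; trans; ↭-sym)
open import Data.List.Relation.Binary.Permutation.Propositional.Properties
  using (∈-resp-↭; ↭-length; shift) renaming (map⁺ to ↭-map⁺)
open import Data.List.Relation.Binary.Sublist.Propositional using (_⊆_; []; _∷_; _∷ʳ_)
open import Data.List.Relation.Binary.Sublist.Propositional.Properties using (All-resp-⊆)
open import Data.List.Relation.Unary.All as All using (All; []; _∷_)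
open import Data.List.Relation.Unary.All.Properties as All using (¬Any⇒All¬)
open import Data.List.Relation.Unary.AllPairs as AllPairs using (AllPairs; []; _∷_)
import Data.List.Relation.Unary.AllPairs.Properties as AllPairs
open import Data.List.Relation.Unary.Any using (here; there; any?)
import Data.List.Relation.Unary.Linked.Properties as Linked
import Data.List.Sort
open import Data.Maybe using (just)
open import Data.Nat using (z≤n; _⊓_; _∸_; _≥_; _≟_; _≤?_)
open import Data.Nat.ListAction using (sum)
open import Data.Nat.ListAction.Properties using (sum-↭; sum-++)
open import Data.Nat.Properties
open import Algebra.Properties.CommutativeSemigroup +-commutativeSemigroup using (interchange; xy∙z≈xz∙y)
open import Data.Product using (∃-syntax; _,_; proj₁; proj₂)
open import Data.Sum using (inj₁; inj₂)
open import Function using (_∘_; flip)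
import Relation.Binary.Construct.Flip.EqAndOrd as Flip
import Relation.Binary.Construct.On as On
open import Relation.Binary.PropositionalEquality
  using (_≡_; refl; sym; cong; cong₂; subst; module ≡-Reasoning) renaming (trans to ≡-trans)
open import Relation.Nullary using (¬_; yes; no; contradiction)

Spread : ℕ → List ℕ → Set
Spread s xs = ∀ {a b} → a ∈ xs → b ∈ xs → a ≤ b + s

Spread-mono : ∀ {s s′ xs} → s ≤ s′ → Spread s xs → Spread s′ xs
Spread-mono s≤s′ sp {b = b} a∈ b∈ = ≤-trans (sp a∈ b∈) (+-monoʳ-≤ b s≤s′)

Spread-resp-↭ : ∀ {s xs ys} → xs ↭ ys → Spread s xs → Spread s ys
Spread-resp-↭ xs↭ys sp a∈ b∈ = sp (∈-resp-↭ (↭-sym xs↭ys) a∈) (∈-resp-↭ (↭-sym xs↭ys) b∈)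

All≤⇒Spread : ∀ {s xs} → All (_≤ s) xs → Spread s xs
All≤⇒Spread {s} xs≤s {b = b} a∈ _ = ≤-trans (All.lookup xs≤s a∈) (m≤n+m s b)

All≤maxL : ∀ xs → All (_≤ maxL xs) xs
All≤maxL []       = []
All≤maxL (x ∷ xs) = m≤m⊔n x (maxL xs) ∷ All.map (λ y≤ → ≤-trans y≤ (m≤n⊔m x (maxL xs))) (All≤maxL xs)

maxL-lub : ∀ {m xs} → All (_≤ m) xs → maxL xs ≤ m
maxL-lub []           = z≤n
maxL-lub (x≤m ∷ xs≤m) = ⊔-lub x≤m (maxL-lub xs≤m)

maxL∈ : ∀ x xs → maxL (x ∷ xs) ∈ x ∷ xs
maxL∈ x []       = here (⊔-identityʳ x)
maxL∈ x (y ∷ ys) with ⊔-sel x (maxL (y ∷ ys))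
... | inj₁ eq = here eq
... | inj₂ eq = there (subst (_∈ y ∷ ys) (sym eq) (maxL∈ y ys))

minL≤All : ∀ xs → All (minL xs ≤_) xs
minL≤All []           = []
minL≤All (x ∷ [])     = ≤-refl ∷ []
minL≤All (x ∷ y ∷ ys) = m⊓n≤m x (minL (y ∷ ys)) ∷ All.map (≤-trans (m⊓n≤n x (minL (y ∷ ys)))) (minL≤All (y ∷ ys))

minL∈ : ∀ x xs → minL (x ∷ xs) ∈ x ∷ xs
minL∈ x []       = here refl
minL∈ x (y ∷ ys) with ⊓-sel x (minL (y ∷ ys))
... | inj₁ eq = here eq
... | inj₂ eq = there (subst (_∈ y ∷ ys) (sym eq) (minL∈ y ys))

Spread⇒maxL∸minL≤ : ∀ {s} xs → Spread s xs → maxL xs ∸ minL xs ≤ s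
Spread⇒maxL∸minL≤ []       _  = z≤n
Spread⇒maxL∸minL≤ (x ∷ xs) sp = m≤n+o⇒m∸n≤o (maxL (x ∷ xs)) (minL (x ∷ xs)) (sp (maxL∈ x xs) (minL∈ x xs))

maxL∸minL≤⇒Spread : ∀ {s} xs → maxL xs ∸ minL xs ≤ s → Spread s xs
maxL∸minL≤⇒Spread {s} xs gap≤s {a} {b} a∈ b∈ = begin
  a                           ≤⟨ All.lookup (All≤maxL xs) a∈ ⟩
  maxL xs                     ≤⟨ m≤n+m∸n (maxL xs) (minL xs) ⟩
  minL xs + (maxL xs ∸ minL xs) ≤⟨ +-mono-≤ (All.lookup (minL≤All xs) b∈) gap≤s ⟩
  b + s                       ∎
  where open ≤-Reasoning

∈-zipWith⁻ : ∀ {A B C : Set} (f : A → B → C) {z} xs ys → z ∈ zipWith f xs ys →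
             ∃[ x ] ∃[ y ] x ∈ xs × y ∈ ys × z ≡ f x y
∈-zipWith⁻ f (x ∷ xs) (y ∷ ys) (here refl) = x , y , here refl , here refl , refl
∈-zipWith⁻ f (x ∷ xs) (y ∷ ys) (there z∈) =
  let x′ , y′ , x′∈ , y′∈ , eq = ∈-zipWith⁻ f xs ys z∈ in x′ , y′ , there x′∈ , there y′∈ , eq

-- Of two pairs, one summand is dominated by monotonicity and the other within the spread.
zipWith-+-Spread : ∀ {s xs ys} → AllPairs _≥_ xs → AllPairs _≤_ ys →
                   Spread s xs → Spread s ys → Spread s (zipWith _+_ xs ys)
zipWith-+-Spread {s} {x ∷ xs} {y ∷ ys} _ _ _ _ (here refl) (here refl) =
  m≤m+n (x + y) s
zipWith-+-Spread {s} {x ∷ xs} {y ∷ ys} _ (y≤ys ∷ _) spx _ (here refl) (there b∈)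
  with x′ , y′ , x′∈ , y′∈ , refl ← ∈-zipWith⁻ _+_ xs ys b∈ =
  ≤-trans (+-mono-≤ (spx (here refl) (there x′∈)) (All.lookup y≤ys y′∈)) (≤-reflexive (xy∙z≈xz∙y x′ s y′))
zipWith-+-Spread {s} {x ∷ xs} {y ∷ ys} (x≥xs ∷ _) _ _ spy (there a∈) (here refl)
  with x′ , y′ , x′∈ , y′∈ , refl ← ∈-zipWith⁻ _+_ xs ys a∈ =
  ≤-trans (+-mono-≤ (All.lookup x≥xs x′∈) (spy (there y′∈) (here refl))) (≤-reflexive (sym (+-assoc x y s)))
zipWith-+-Spread {xs = _ ∷ _} {_ ∷ _} (_ ∷ ≥xs) (_ ∷ ≤ys) spx spy (there a∈) (there b∈) =
  zipWith-+-Spread ≥xs ≤ys (λ a b → spx (there a) (there b)) (λ a b → spy (there a) (there b)) a∈ b∈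

sum≤length* : ∀ {m xs} → All (_≤ m) xs → sum xs ≤ length xs * m
sum≤length* []           = z≤n
sum≤length* (x≤m ∷ xs≤m) = +-mono-≤ x≤m (sum≤length* xs≤m)

length*≤sum : ∀ {m xs} → All (m ≤_) xs → length xs * m ≤ sum xs
length*≤sum []           = z≤n
length*≤sum (m≤x ∷ m≤xs) = +-mono-≤ m≤x (length*≤sum m≤xs)

∃≤average : ∀ {m} x xs → sum (x ∷ xs) ≤ length (x ∷ xs) * m → ∃[ b ] b ∈ x ∷ xs × b ≤ m
∃≤average {m} x xs sum≤ with any? (_≤? m) (x ∷ xs)
... | yes some≤m = find some≤m
... | no  none≤m = contradiction
  (≤-trans (length*≤sum (All.map ≰⇒> (¬Any⇒All¬ (x ∷ xs) none≤m))) sum≤)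
  (<⇒≱ (*-monoʳ-< (length (x ∷ xs)) (n<1+n m)))

All≤average+Spread : ∀ {s m} xs → Spread s xs → sum xs ≤ length xs * m → All (_≤ m + s) xs
All≤average+Spread []       _  _    = []
All≤average+Spread {s} (x ∷ xs) sp sum≤ =
  let b , b∈ , b≤m = ∃≤average x xs sum≤ in
  All.tabulate (λ a∈ → ≤-trans (sp a∈ b∈) (+-monoˡ-≤ s b≤m))

sumLen : ∀ {T} → Profile T → ℕ
sumLen P = sum (map len P)

Disjoint : ∀ {T} → Path T → Path T → Set
Disjoint {T} p q = (a : Arc T) → Uses p a → ¬ Uses q a

ArcDisjoint⇒AllPairs : ∀ {T} {P : Profile T} → ArcDisjoint P → AllPairs Disjoint P
ArcDisjoint⇒AllPairs {P = P} disj =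
  subst (AllPairs Disjoint) (tabulate-lookup P) (AllPairs.tabulate⁺ (disj _ _))

len≤maxLen : ∀ {T} (P : Profile T) → All (λ p → len p ≤ maxLen P) P
len≤maxLen P = All.map⁻ (All≤maxL (map len P))

maxLen≤⇒All : ∀ {T m} {P : Profile T} → maxLen P ≤ m → All (λ p → len p ≤ m) P
maxLen≤⇒All {P = P} P≤m = All.map (λ p≤ → ≤-trans p≤ P≤m) (len≤maxLen P)

maxLen-lub : ∀ {T m} {P : Profile T} → All (λ p → len p ≤ m) P → maxLen P ≤ m
maxLen-lub = maxL-lub ∘ All.map⁺

sumLen-↭ : ∀ {T} {P Q : Profile T} → P ↭ Q → sumLen P ≡ sumLen Q
sumLen-↭ P↭Q = sum-↭ (↭-map⁺ len P↭Q)

length-zipWith-⨾ : ∀ {A B} (P : Profile A) (Q : Profile B) → length P ≡ length Q →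
                   length (zipWith _⨾_ P Q) ≡ length P
length-zipWith-⨾ P Q eq =
  ≡-trans (length-zipWith _⨾_ P Q) (≡-trans (cong (length P ⊓_) (sym eq)) (⊓-idem (length P)))

sumLen-zipWith-⨾ : ∀ {A B} (P : Profile A) (Q : Profile B) → length P ≡ length Q →
                   sumLen (zipWith _⨾_ P Q) ≡ sumLen P + sumLen Q
sumLen-zipWith-⨾ []      []      _  = refl
sumLen-zipWith-⨾ (p ∷ P) (q ∷ Q) eq = begin
  len p + len q + sumLen (zipWith _⨾_ P Q)   ≡⟨ cong (len p + len q +_) (sumLen-zipWith-⨾ P Q (suc-injective eq)) ⟩
  len p + len q + (sumLen P + sumLen Q)      ≡⟨ interchange (len p) (len q) (sumLen P) (sumLen Q) ⟩
  len p + sumLen P + (len q + sumLen Q)      ∎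
  where open ≡-Reasoning

length-greedyPar : ∀ {A B} (P : Profile A) (Q : Profile B) →
                   length (greedyPar P Q) ≡ length P + length Q
length-greedyPar P Q =
  ≡-trans (length-++ (map left P)) (cong₂ _+_ (length-map left P) (length-map right Q))

sumLen-greedyPar : ∀ {A B} (P : Profile A) (Q : Profile B) →
                   sumLen (greedyPar P Q) ≡ sumLen P + sumLen Q
sumLen-greedyPar P Q = begin
  sum (map len (map left P ++ map right Q))            ≡⟨ cong sum (map-++ len (map left P) (map right Q)) ⟩
  sum (map len (map left P) ++ map len (map right Q))  ≡⟨ sum-++ (map len (map left P)) (map len (map right Q)) ⟩
  sumLen (map left P) + sumLen (map right Q)           ≡⟨ cong₂ _+_ (cong sum (sym (map-∘ P))) (cong sum (sym (map-∘ Q))) ⟩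
  sumLen P + sumLen Q                                  ∎
  where open ≡-Reasoning

fstP : ∀ {A B} → Path (ser A B) → Path A
fstP (p ⨾ q) = p

sndP : ∀ {A B} → Path (ser A B) → Path B
sndP (p ⨾ q) = q

len-fstP≤ : ∀ {A B} (r : Path (ser A B)) → len (fstP r) ≤ len r
len-fstP≤ (p ⨾ q) = m≤m+n (len p) (len q)

len-sndP≤ : ∀ {A B} (r : Path (ser A B)) → len (sndP r) ≤ len r
len-sndP≤ (p ⨾ q) = m≤n+m (len q) (len p)

Disjoint-fstP : ∀ {A B} {r r′ : Path (ser A B)} → Disjoint r r′ → Disjoint (fstP r) (fstP r′)
Disjoint-fstP {r = p ⨾ q} {p′ ⨾ q′} disj a u u′ = disj (inS₁ a) (uS₁ u) (uS₁ u′)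

Disjoint-sndP : ∀ {A B} {r r′ : Path (ser A B)} → Disjoint r r′ → Disjoint (sndP r) (sndP r′)
Disjoint-sndP {r = p ⨾ q} {p′ ⨾ q′} disj a u u′ = disj (inS₂ a) (uS₂ u) (uS₂ u′)

AllPairs-Disjoint-fstP : ∀ {A B} {Q : Profile (ser A B)} → AllPairs Disjoint Q → AllPairs Disjoint (map fstP Q)
AllPairs-Disjoint-fstP = AllPairs.map⁺ ∘ AllPairs.map Disjoint-fstP

AllPairs-Disjoint-sndP : ∀ {A B} {Q : Profile (ser A B)} → AllPairs Disjoint Q → AllPairs Disjoint (map sndP Q)
AllPairs-Disjoint-sndP = AllPairs.map⁺ ∘ AllPairs.map Disjoint-sndP

All≤-fstP : ∀ {A B m} {Q : Profile (ser A B)} → All (λ q → len q ≤ m) Q → All (λ p → len p ≤ m) (map fstP Q)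
All≤-fstP = All.map⁺ ∘ All.map (λ {r} → ≤-trans (len-fstP≤ r))

All≤-sndP : ∀ {A B m} {Q : Profile (ser A B)} → All (λ q → len q ≤ m) Q → All (λ q → len q ≤ m) (map sndP Q)
All≤-sndP = All.map⁺ ∘ All.map (λ {r} → ≤-trans (len-sndP≤ r))

zipWith-⨾-fstP-sndP : ∀ {A B} (Q : Profile (ser A B)) → zipWith _⨾_ (map fstP Q) (map sndP Q) ≡ Q
zipWith-⨾-fstP-sndP []            = refl
zipWith-⨾-fstP-sndP ((p ⨾ q) ∷ Q) = cong (p ⨾ q ∷_) (zipWith-⨾-fstP-sndP Q)

sumLen-fstP+sndP : ∀ {A B} (Q : Profile (ser A B)) → sumLen (map fstP Q) + sumLen (map sndP Q) ≡ sumLen Q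
sumLen-fstP+sndP Q = ≡-trans
  (sym (sumLen-zipWith-⨾ (map fstP Q) (map sndP Q) (≡-trans (length-map fstP Q) (sym (length-map sndP Q)))))
  (cong sumLen (zipWith-⨾-fstP-sndP Q))

lefts : ∀ {A B} → Profile (par A B) → Profile A
lefts []            = []
lefts (left p ∷ Q)  = p ∷ lefts Q
lefts (right q ∷ Q) = lefts Q

rights : ∀ {A B} → Profile (par A B) → Profile B
rights []            = []
rights (left p ∷ Q)  = rights Q
rights (right q ∷ Q) = q ∷ rights Q

map-left-lefts-⊆ : ∀ {A B} (Q : Profile (par A B)) → map left (lefts Q) ⊆ Q
map-left-lefts-⊆ []            = []
map-left-lefts-⊆ (left p ∷ Q)  = refl ∷ map-left-lefts-⊆ Q
map-left-lefts-⊆ (right q ∷ Q) = right q ∷ʳ map-left-lefts-⊆ Q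

map-right-rights-⊆ : ∀ {A B} (Q : Profile (par A B)) → map right (rights Q) ⊆ Q
map-right-rights-⊆ []            = []
map-right-rights-⊆ (left p ∷ Q)  = left p ∷ʳ map-right-rights-⊆ Q
map-right-rights-⊆ (right q ∷ Q) = refl ∷ map-right-rights-⊆ Q

↭-greedyPar-lefts-rights : ∀ {A B} (Q : Profile (par A B)) → Q ↭ greedyPar (lefts Q) (rights Q)
↭-greedyPar-lefts-rights []            = refl
↭-greedyPar-lefts-rights (left p ∷ Q)  = prep (left p) (↭-greedyPar-lefts-rights Q)
↭-greedyPar-lefts-rights (right q ∷ Q) =
  trans (prep (right q) (↭-greedyPar-lefts-rights Q)) (↭-sym (shift (right q) (map left (lefts Q)) (map right (rights Q))))

AllPairs-resp-⊆ : ∀ {A : Set} {R : A → A → Set} {xs ys} → xs ⊆ ys → AllPairs R ys → AllPairs R xs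
AllPairs-resp-⊆ []         []          = []
AllPairs-resp-⊆ (_ ∷ʳ τ)   (_ ∷ Rys)   = AllPairs-resp-⊆ τ Rys
AllPairs-resp-⊆ (refl ∷ τ) (Ry ∷ Rys)  = All-resp-⊆ τ Ry ∷ AllPairs-resp-⊆ τ Rys

AllPairs-Disjoint-lefts : ∀ {A B} {Q : Profile (par A B)} → AllPairs Disjoint Q → AllPairs Disjoint (lefts Q)
AllPairs-Disjoint-lefts {Q = Q} disj =
  AllPairs.map (λ d a u u′ → d (inP₁ a) (uP₁ u) (uP₁ u′))
               (AllPairs.map⁻ (AllPairs-resp-⊆ (map-left-lefts-⊆ Q) disj))

AllPairs-Disjoint-rights : ∀ {A B} {Q : Profile (par A B)} → AllPairs Disjoint Q → AllPairs Disjoint (rights Q)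
AllPairs-Disjoint-rights {Q = Q} disj =
  AllPairs.map (λ d a u u′ → d (inP₂ a) (uP₂ u) (uP₂ u′))
               (AllPairs.map⁻ (AllPairs-resp-⊆ (map-right-rights-⊆ Q) disj))

All≤-lefts : ∀ {A B m} {Q : Profile (par A B)} → All (λ q → len q ≤ m) Q → All (λ p → len p ≤ m) (lefts Q)
All≤-lefts {Q = Q} = All.map⁻ ∘ All-resp-⊆ (map-left-lefts-⊆ Q)

All≤-rights : ∀ {A B m} {Q : Profile (par A B)} → All (λ q → len q ≤ m) Q → All (λ q → len q ≤ m) (rights Q)
All≤-rights {Q = Q} = All.map⁻ ∘ All-resp-⊆ (map-right-rights-⊆ Q)

module SortByLength (T : SP) = Data.List.Sort (On.decTotalOrder ≤-decTotalOrder (len {T}))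
module SortByLengthDesc (T : SP) = Data.List.Sort (Flip.decTotalOrder (On.decTotalOrder ≤-decTotalOrder (len {T})))

greedySer-exists : ∀ {A B} (P : Profile A) (Q : Profile B) → length P ≡ length Q → ∃[ R ] GreedySer P Q R
greedySer-exists {A} {B} P Q eq =
  zipWith _⨾_ P′ Q′ , P′ , Q′ , ↭-sym (Desc.sort-↭ P) , ↭-sym (Asc.sort-↭ Q) ,
  Desc.sort-↗ P , Asc.sort-↗ Q , lengths , refl
  where
  module Desc = SortByLengthDesc A
  module Asc  = SortByLength B
  P′ = Desc.sort P
  Q′ = Asc.sort Q
  lengths : length P′ ≡ length Q′
  lengths = ≡-trans (↭-length (Desc.sort-↭ P)) (≡-trans eq (sym (↭-length (Asc.sort-↭ Q))))

length-greedySer : ∀ {A B} {P : Profile A} {Q : Profile B} {R} → GreedySer P Q R → length R ≡ length P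
length-greedySer (P′ , Q′ , P↭ , _ , _ , _ , eq , refl) =
  ≡-trans (length-zipWith-⨾ P′ Q′ eq) (sym (↭-length P↭))

sumLen-greedySer : ∀ {A B} {P : Profile A} {Q : Profile B} {R} → GreedySer P Q R → sumLen R ≡ sumLen P + sumLen Q
sumLen-greedySer (P′ , Q′ , P↭ , Q↭ , _ , _ , eq , refl) =
  ≡-trans (sumLen-zipWith-⨾ P′ Q′ eq) (sym (cong₂ _+_ (sumLen-↭ P↭) (sumLen-↭ Q↭)))

Spread-greedySer : ∀ {A B s} {P : Profile A} {Q : Profile B} {R} → GreedySer P Q R →
                   Spread s (map len P) → Spread s (map len Q) → Spread s (map len R)
Spread-greedySer {s = s} (P′ , Q′ , P↭ , Q↭ , P′≥ , Q′≤ , _ , refl) spP spQ =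
  subst (Spread s) (sym map-len-zip)
    (zipWith-+-Spread (Linked.Linked⇒AllPairs (flip ≤-trans) (Linked.map⁺ P′≥))
                      (Linked.Linked⇒AllPairs ≤-trans (Linked.map⁺ Q′≤))
                      (Spread-resp-↭ (↭-map⁺ len P↭) spP) (Spread-resp-↭ (↭-map⁺ len Q↭) spQ))
  where
  map-len-zip : map len (zipWith _⨾_ P′ Q′) ≡ zipWith _+_ (map len P′) (map len Q′)
  map-len-zip = ≡-trans (map-zipWith _⨾_ len P′ Q′) (sym (zipWith-map _+_ len len P′ Q′))

CellsConsistent : ∀ {T} → Table T → Set
CellsConsistent tab = ∀ {k θ R} → tab k θ ≡ just R → length R ≡ k × sumLen R ≡ θ

arcCell-consistent : ∀ τ → CellsConsistent (arcCell τ)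
arcCell-consistent τ {0} {0} refl = refl , refl
arcCell-consistent τ {1} {θ} _ with θ ≟ τ
arcCell-consistent τ {1} {θ} refl | yes θ≡τ = refl , ≡-trans (+-identityʳ τ) (sym θ≡τ)

arcCell-single : ∀ τ → arcCell τ 1 τ ≡ just (single ∷ [])
arcCell-single τ with τ ≟ τ
... | yes _   = refl
... | no τ≢τ = contradiction refl τ≢τ

selected-candidate : ∀ {T} {cost : Profile T → ℕ} {Cand m R} → Selected cost Cand m → m ≡ just R → Cand R
selected-candidate (some R cand _) refl = cand

selected-optimal : ∀ {T} {cost : Profile T → ℕ} {Cand m R₀} → Selected cost Cand m → Cand R₀ →
                   ∃[ R ] m ≡ just R × cost R ≤ cost R₀
selected-optimal (none no-cand)        cand₀ = ⊥-elim (no-cand _ cand₀)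
selected-optimal (some R _ R-optimal) cand₀ = R , refl , R-optimal _ cand₀

run-consistent : ∀ {T tab} → DPRun T tab → CellsConsistent tab
run-consistent (runArc cells) {k} {θ} eq = arcCell-consistent _ (≡-trans (sym (cells k θ)) eq)
run-consistent (runSer rA rB sel) {k} {θ} eq
  with _ , _ , θ₁+θ₂≡θ , P , Q , P∈tA , Q∈tB , greedy ← selected-candidate (sel k θ) eq =
  ≡-trans (length-greedySer greedy) (proj₁ (run-consistent rA P∈tA)) ,
  ≡-trans (sumLen-greedySer greedy) (≡-trans (cong₂ _+_ (proj₂ (run-consistent rA P∈tA)) (proj₂ (run-consistent rB Q∈tB))) θ₁+θ₂≡θ)
run-consistent (runPar rA rB sel) {k} {θ} eq
  with _ , _ , _ , _ , k₁+k₂≡k , θ₁+θ₂≡θ , P , Q , P∈tA , Q∈tB , refl ← selected-candidate (sel k θ) eq =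
  ≡-trans (length-greedyPar P Q) (≡-trans (cong₂ _+_ (proj₁ (run-consistent rA P∈tA)) (proj₁ (run-consistent rB Q∈tB))) k₁+k₂≡k) ,
  ≡-trans (sumLen-greedyPar P Q) (≡-trans (cong₂ _+_ (proj₂ (run-consistent rA P∈tA)) (proj₂ (run-consistent rB Q∈tB))) θ₁+θ₂≡θ)

series-step : ∀ {A B tA tB} {tab : Table (ser A B)} → DPRun A tA → DPRun B tB →
  (sel : ∀ k θ → Selected serCost (SerCand tA tB k θ) (tab k θ)) →
  ∀ {s m k θ₁ θ₂ θ RA RB} → tA k θ₁ ≡ just RA → tB k θ₂ ≡ just RB → θ₁ + θ₂ ≡ θ → θ ≤ k * m →
  Spread s (map len RA) → Spread s (map len RB) →
  ∃[ R ] tab k θ ≡ just R × All (λ r → len r ≤ m + s) R × Spread s (map len R)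
series-step rA rB sel {s} {m} {k} {θ = θ} {RA} {RB} RA∈tA RB∈tB θ₁+θ₂≡θ θ≤km spA spB
  with R₀ , greedy ← greedySer-exists RA RB (≡-trans (proj₁ (run-consistent rA RA∈tA)) (sym (proj₁ (run-consistent rB RB∈tB))))
  with R , R∈tab , R≤R₀ ← selected-optimal (sel k θ) (_ , _ , θ₁+θ₂≡θ , RA , RB , RA∈tA , RB∈tB , greedy) =
  R , R∈tab , All.map⁻ (All≤average+Spread (map len R) spR average≤m) , spR
  where
  spR : Spread s (map len R)
  spR = maxL∸minL≤⇒Spread (map len R) (≤-trans R≤R₀ (Spread⇒maxL∸minL≤ (map len R₀) (Spread-greedySer greedy spA spB)))
  average≤m : sum (map len R) ≤ length (map len R) * m
  average≤m with length≡k , sumLen≡θ ← run-consistent (runSer rA rB sel) R∈tab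
    rewrite length-map len R | length≡k | sumLen≡θ = θ≤km

parallel-step : ∀ {A B tA tB} {tab : Table (par A B)} →
  (sel : ∀ k θ → Selected parCost (ParCand tA tB k θ) (tab k θ)) →
  ∀ {m k₁ k₂ k θ₁ θ₂ θ RA RB} → tA k₁ θ₁ ≡ just RA → tB k₂ θ₂ ≡ just RB → k₁ + k₂ ≡ k → θ₁ + θ₂ ≡ θ →
  All (λ r → len r ≤ m) RA → All (λ r → len r ≤ m) RB →
  ∃[ R ] tab k θ ≡ just R × All (λ r → len r ≤ m) R
parallel-step sel {m} {k = k} {θ = θ} {RA} {RB} RA∈tA RB∈tB k₁+k₂≡k θ₁+θ₂≡θ RA≤m RB≤m
  with R , R∈tab , R≤R₀ ← selected-optimal (sel k θ) (_ , _ , _ , _ , k₁+k₂≡k , θ₁+θ₂≡θ , RA , RB , RA∈tA , RB∈tB , refl) =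
  R , R∈tab , maxLen≤⇒All (≤-trans R≤R₀ greedy≤m)
  where
  greedy≤m : maxLen (greedyPar RA RB) ≤ m
  greedy≤m = maxLen-lub (All.++⁺ (All.map⁺ RA≤m) (All.map⁺ RB≤m))

[+1]*-monoˡ-≤ : ∀ m {a b} → a ≤ b → (a + 1) * m ≤ (b + 1) * m
[+1]*-monoˡ-≤ m a≤b = *-monoˡ-≤ m (+-monoˡ-≤ 1 a≤b)

-- phiAux true T does not count the S-component of T itself.
Approximates : (T : SP) → ℕ → Profile T → Set
Approximates T m R =
  All (λ r → len r ≤ (phi T + 1) * m) R × Spread ((phiAux true T + 1) * m) (map len R)

cell-approximates : ∀ {T tab} → DPRun T tab → ∀ {m} {Q : Profile T} → AllPairs Disjoint Q → All (λ q → len q ≤ m) Q →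
  ∃[ R ] tab (length Q) (sumLen Q) ≡ just R × Approximates T m R
cell-approximates (runArc cells) {Q = []} _ _ = [] , cells 0 0 , [] , λ ()
cell-approximates (runArc {τ} {tab} cells) {m} {single ∷ []} _ (τ≤m ∷ []) =
  single ∷ [] , cell , τ≤m′ ∷ [] , All≤⇒Spread (τ≤m′ ∷ [])
  where
  τ≤m′ : τ ≤ (0 + 1) * m
  τ≤m′ = ≤-trans τ≤m (≤-reflexive (sym (*-identityˡ m)))
  cell : tab 1 (τ + 0) ≡ just (single ∷ [])
  cell = ≡-trans (cells 1 (τ + 0))
           (subst (λ θ → arcCell τ 1 θ ≡ just (single ∷ [])) (sym (+-identityʳ τ)) (arcCell-single τ))
cell-approximates (runArc cells) {Q = single ∷ single ∷ _} ((disj ∷ _) ∷ _) _ = ⊥-elim (disj this uThis uThis)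
cell-approximates {ser A B} (runSer {tA = tA} {tB} rA rB sel) {m} {Q} disj Q≤m
  with RA , RA∈tA , _ , spA ← cell-approximates rA (AllPairs-Disjoint-fstP disj) (All≤-fstP Q≤m)
     | RB , RB∈tB , _ , spB ← cell-approximates rB (AllPairs-Disjoint-sndP disj) (All≤-sndP Q≤m)
  with R , R∈tab , R≤ , spR ←
    series-step rA rB sel
      (subst (λ k → tA k (sumLen (map fstP Q)) ≡ just RA) (length-map fstP Q) RA∈tA)
      (subst (λ k → tB k (sumLen (map sndP Q)) ≡ just RB) (length-map sndP Q) RB∈tB)
      (sumLen-fstP+sndP Q)
      (subst (λ n → sumLen Q ≤ n * m) (length-map len Q) (sum≤length* (All.map⁺ Q≤m)))
      (Spread-mono ([+1]*-monoˡ-≤ m (m≤m⊔n (phiAux true A) (phiAux true B))) spA)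
      (Spread-mono ([+1]*-monoˡ-≤ m (m≤n⊔m (phiAux true A) (phiAux true B))) spB)
  = R , R∈tab , R≤ , spR
cell-approximates {par A B} (runPar rA rB sel) {m} {Q} disj Q≤m
  with RA , RA∈tA , RA≤ , _ ← cell-approximates rA (AllPairs-Disjoint-lefts disj) (All≤-lefts Q≤m)
     | RB , RB∈tB , RB≤ , _ ← cell-approximates rB (AllPairs-Disjoint-rights disj) (All≤-rights Q≤m)
  with R , R∈tab , R≤ ←
    parallel-step sel RA∈tA RB∈tB
      (≡-trans (sym (length-greedyPar (lefts Q) (rights Q))) (sym (↭-length (↭-greedyPar-lefts-rights Q))))
      (≡-trans (sym (sumLen-greedyPar (lefts Q) (rights Q))) (sym (sumLen-↭ (↭-greedyPar-lefts-rights Q))))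
      (All.map (λ r≤ → ≤-trans r≤ ([+1]*-monoˡ-≤ m (m≤m⊔n (phi A) (phi B)))) RA≤)
      (All.map (λ r≤ → ≤-trans r≤ ([+1]*-monoˡ-≤ m (m≤n⊔m (phi A) (phi B)))) RB≤)
  = R , R∈tab , R≤ , All≤⇒Spread (All.map⁺ R≤)

lemma14 : (D : SP) (k : ℕ) (tab : Table D) → DPRun D tab →
    (R : Profile D) → DPOutput tab k R →
    (P : Profile D) → Feasible D k P →
    maxLen R ≤ (phi D + 1) * maxLen P
lemma14 D _ tab run R ((_ , R∈tab) , R-minimal) P (length≡k , disjoint)
  with R* , R*∈tab , R*-bounded , _ ← cell-approximates run (ArcDisjoint⇒AllPairs disjoint) (len≤maxLen P) =
  begin
    maxLen R                ≤⟨ R-minimal (sumLen P) R* (subst (λ k → tab k (sumLen P) ≡ just R*) length≡k R*∈tab) ⟩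
    maxLen R*               ≤⟨ maxLen-lub R*-bounded ⟩
    (phi D + 1) * maxLen P  ∎
  where open ≤-Reasoning
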